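{- Assume Hypothesis H (described in the context) holds. Let $B\in\mathcal{B}$ and $X:=(G_B)^{\mathcal{C}}$, the permutation group induced on $\mathcal{C}$ by the setwise stabiliser $G_B$ (a subgroup of $D$). Let $c_0$ be the (constant) length of the $K$-orbits in $\mathcal{P}$, and let $x:=c_0/\gcd(c_0,\ell)$. Then $X$ has an orbit of length $k/\ell$ in $\mathcal{C}$, and (a) if $c_0=1$ (equivalently, $K=1$), then $|D:X|=b$; (b) if $c_0>1$, then $c_0$ divides $c$, $x$ divides $b$, and $|D:X|$ divides $b/x$.
   Context: A $2$-$(v,k,\lambda)$ design $\mathcal{D}=(\mathcal{P},\mathcal{B})$: $\mathcal{P}$ is a set of $v$ points, $\mathcal{B}$ a set of $b$ blocks, each a $k$-subset of $\mathcal{P}$, each pair of distinct points lying in exactly $\lambda$ blocks, with $2<k<v$; $r$ is the number of blocks containing a given point. Automorphisms are permutations of $\mathcal{P}$ preserving $\mathcal{B}$; a flag is a pair $(\alpha,B)$ with $\alpha\in B\in\mathcal{B}$. Hypothesis H: (a) $\mathcal{D}$ is such a design; (b) $G$ is a group of automorphisms of $\mathcal{D}$ transitive on flags, leaving invariant a partition $\mathcal{C}=\{\Delta_1,\dots,\Delta_d\}$ of $\mathcal{P}$ with $d\geq 2$ classes each of size $c\geq 2$; $D=G^{\mathcal{C}}$ is the permutation group induced by $G$ on $\mathcal{C}$, $L=(G_\Delta)^\Delta$ is the permutation group induced on a class $\Delta\in\mathcal{C}$ by its setwise stabiliser $G_\Delta$, $G$ is regarded as a subgroup of $L\wr D$,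 and $K=G_{(\mathcal{C})}$ is the kernel of the action of $G$ on $\mathcal{C}$; (c) for every block $B$ and class $\Delta$ with $B\cap\Delta\neq\emptyset$ the size $\ell=|B\cap\Delta|$ is independent of $B,\Delta$, and $\ell\geq 2$. -}

module Defs where

open import Data.Nat using (ℕ; zero; suc; _+_; _*_; _≤_; _<_; NonZero; ≢-nonZero; s≤s; z≤n)
open import Data.Nat.DivMod using (_/_)
open import Data.Nat.GCD using (gcd; gcd[m,n]≢0)
open import Data.Nat.Divisibility using (_∣_)
open import Data.Bool using (Bool; true; false; _∧_)
open import Data.Fin using (Fin; _≟_)
open import Data.Fin.Subset using (Subset; ∣_∣)
open import Data.Vec using (Vec; lookup; tabulate; allFin)
open import Data.List using (List; length)
open import Data.List.Membership.Propositional using (_∈_)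
open import Data.List.Relation.Unary.Unique.Propositional using (Unique)
open import Data.Product using (Σ; ∃; ∃-syntax; _×_; _,_)
open import Data.Sum using (inj₂)
open import Function.Bundles using (_⇔_)
open import Relation.Nullary using (¬_; ⌊_⌋)
open import Relation.Binary.PropositionalEquality using (_≡_; _≢_)

HasSize : {A : Set} → (A → Set) → ℕ → Set
HasSize {A} P n = Σ (List A) λ xs → Unique xs × (∀ a → (a ∈ xs) ⇔ P a) × length xs ≡ n

count : {n : ℕ} → (Fin n → Bool) → ℕ
count f = ∣ tabulate f ∣

divNZ : ℕ → (n : ℕ) → n ≢ 0 → ℕ
divNZ m n nz = _/_ m n {{≢-nonZero nz}}

2≤⇒≢0 : {n : ℕ} → 2 ≤ n → n ≢ 0
2≤⇒≢0 (s≤s _) ()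

_/[_,_] : ℕ → (ℓ : ℕ) → 2 ≤ ℓ → ℕ
k /[ ℓ , p ] = divNZ k ℓ (2≤⇒≢0 p)

xOf : (c0 ℓ : ℕ) → 2 ≤ ℓ → ℕ
xOf c0 ℓ p = divNZ c0 (gcd c0 ℓ) (gcd[m,n]≢0 c0 ℓ (inj₂ (2≤⇒≢0 p)))

-- Permutations of Fin n, represented by their table of values
-- (g sends α to lookup g α).

Perm : ℕ → Set
Perm n = Vec (Fin n) n

_∘ₚ_ : {n : ℕ} → Perm n → Perm n → Perm n
g ∘ₚ h = tabulate (λ α → lookup g (lookup h α))

-- Designs.  Points are Fin v, blocks are given by an injective
-- family blk : Fin b → Subset v (so B is a set of b blocks).

module _ {v b : ℕ} (blk : Fin b → Subset v) where

  InBlock : Fin v → Fin b → Set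
  InBlock α j = lookup (blk j) α ≡ true

  record Design2 (k lam : ℕ) : Set where
    field
      blk-inj  : ∀ i j → blk i ≡ blk j → i ≡ j
      blk-size : ∀ j → ∣ blk j ∣ ≡ k
      balanced : ∀ α β → α ≢ β →
                 count (λ j → lookup (blk j) α ∧ lookup (blk j) β) ≡ lam
      2<k      : 2 < k
      k<v      : k < v

  MapsBlock : Perm v → Fin b → Fin b → Set
  MapsBlock g i j = ∀ α → lookup (blk i) α ≡ lookup (blk j) (lookup g α)

  record AutGroup (G : List (Perm v)) : Set where
    field
      is-perm : ∀ g → g ∈ G → ∀ α β → lookup g α ≡ lookup g β → α ≡ β
      id∈     : allFin v ∈ G
      comp∈   : ∀ g h → g ∈ G → h ∈ G → (g ∘ₚ h) ∈ G
      inv∈    : ∀ g → g ∈ G → ∃[ h ] (h ∈ G × (h ∘ₚ g) ≡ allFin v)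
      aut     : ∀ g → g ∈ G → ∀ i → ∃[ j ] MapsBlock g i j

  FlagTransitive : List (Perm v) → Set
  FlagTransitive G = ∀ α i β j → InBlock α i → InBlock β j →
    ∃[ g ] (g ∈ G × lookup g α ≡ β × MapsBlock g i j)

  -- The G-invariant partition C, given by cls : Fin v → Fin d
  -- (class of each point), d classes each of size c.

  module _ {d : ℕ} (G : List (Perm v)) (cls : Fin v → Fin d) where

    record InvPartition (c : ℕ) : Set where
      field
        2≤d       : 2 ≤ d
        2≤c       : 2 ≤ c
        classSize : ∀ δ → count (λ α → ⌊ cls α ≟ δ ⌋) ≡ c
        invariant : ∀ g → g ∈ G → ∀ α β → cls α ≡ cls β →
                    cls (lookup g α) ≡ cls (lookup g β)

    Induces : Perm v → Perm d → Set
    Induces g σ = ∀ α → lookup σ (cls α) ≡ cls (lookup g α)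

    InD : Perm d → Set
    InD σ = ∃[ g ] (g ∈ G × Induces g σ)

    InX : Fin b → Perm d → Set
    InX i σ = ∃[ g ] (g ∈ G × MapsBlock g i i × Induces g σ)

    InK : Perm v → Set
    InK g = g ∈ G × (∀ α → cls (lookup g α) ≡ cls α)

    KOrbit : Fin v → Fin v → Set
    KOrbit α β = ∃[ g ] (InK g × lookup g α ≡ β)

    XOrbit : Fin b → Fin d → Fin d → Set
    XOrbit i δ δ' = ∃[ σ ] (InX i σ × lookup σ δ ≡ δ')

    meet : Fin b → Fin d → ℕ
    meet i δ = count (λ α → lookup (blk i) α ∧ ⌊ cls α ≟ δ ⌋)

{-# OPTIONS --safe #-}
module Submission where

-- Let y be the length of the K-orbit of the block B.  As K is normal in G and G is transitive on
-- blocks, all K-orbits on blocks have length y, so y ∣ b.  Double count the pairs (σ, B′) where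
-- σ ∈ D is induced by some g ∈ G with B^g = B′: the elements inducing σ form a coset of K, so σ
-- is paired with a whole K-orbit of blocks, and the σ paired with a fixed B′ form a coset of X.
-- Hence |D| y = b |X|, i.e. |D:X| y = b; if c0 = 1 then K fixes every point and y = 1.
-- By flag-transitivity the classes meeting B form one X-orbit, and double counting the pairs
-- (α, Δ) with α ∈ B ∩ Δ shows that there are k/ℓ of them.
-- K fixes each class Δ and splits it into orbits of length c0, so c0 ∣ c.  The number of blocks of
-- the K-orbit of B through α is constant on K-orbits, and its sum over α ∈ Δ is y ℓ, since each
-- of these blocks meets Δ in ℓ points; so c0 ∣ y ℓ, and x = c0 / gcd(c0, ℓ) divides y.

open import Defs
open import Data.Bool using (Bool; true; false; _∧_)
open import Data.Bool.Properties using (T-≡; T-∧) renaming (_≟_ to _≟ᵇ_)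
open import Data.Empty using (⊥-elim)
open import Data.Fin as Fin using (Fin; zero; suc)
import Data.Fin.Properties as Finₚ
open import Data.Fin.Subset using (Subset; ∣_∣)
open import Data.List as List using (List; []; _∷_; length; filter; map)
open import Data.List.Properties using (length-map; length-tabulate; length-filter; filter-reject)
open import Data.List.Membership.Propositional using (_∈_; find; lose)
open import Data.List.Membership.Propositional.Properties
  using (∈-filter⁺; ∈-filter⁻; ∈-map⁺; ∈-map⁻; ∈-allFin)
open import Data.List.Membership.Propositional.Properties.WithK using (unique∧set⇒bag)
open import Data.List.Relation.Binary.BagAndSetEquality using (∼bag⇒↭)
open import Data.List.Relation.Binary.Permutation.Propositional.Properties using (↭-length)
open import Data.List.Relation.Unary.All as All using (All; []; _∷_)
import Data.List.Relation.Unary.All.Properties as All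
open import Data.List.Relation.Unary.Any using (here; there; any?)
open import Data.List.Relation.Unary.Unique.Propositional using (Unique; []; _∷_)
open import Data.List.Relation.Unary.Unique.Propositional.Properties
  using (allFin⁺; filter⁺) renaming (map⁺ to Unique-map⁺)
open import Data.Nat
open import Data.Nat.Coprimality using (coprime-/gcd; coprime-divisor)
open import Data.Nat.Divisibility
open import Data.Nat.DivMod using (_/_; m/n*n≡m; m*n/n≡m)
open import Data.Nat.GCD using (gcd; gcd[m,n]≢0; gcd[m,n]∣m; gcd[m,n]∣n)
open import Data.Nat.Properties
open import Algebra.Properties.CommutativeSemigroup +-commutativeSemigroup
  using (interchange; x∙yz≈y∙xz)
open import Algebra.Properties.CommutativeSemigroup *-commutativeSemigroup
  using (xy∙z≈xz∙y)
open import Data.Product using (Σ; ∃; ∃-syntax; _×_; _,_; proj₁; proj₂; uncurry; swap)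
open import Data.Product.Function.NonDependent.Propositional using (_×-⇔_)
open import Data.Sum using (inj₂)
open import Data.Unit using (⊤; tt)
open import Data.Vec using (lookup; tabulate; allFin)
open import Data.Vec.Properties using (lookup∘tabulate; lookup-allFin; tabulate∘lookup)
open import Data.Vec.Relation.Binary.Pointwise.Extensional using (ext; Pointwise-≡⇒≡)
open import Function using (_∘_; id; const; case_of_)
open import Function.Bundles using (_⇔_; mk⇔; Equivalence)
open import Function.Properties.Equivalence using ()
  renaming (refl to ⇔-refl; trans to ⇔-trans; sym to ⇔-sym)
open import Relation.Binary.Definitions using (DecidableEquality)
open import Relation.Binary.PropositionalEquality
open import Relation.Binary.Structures using (IsEquivalence)
open import Relation.Nullary using (¬_; Dec; yes; no; ¬?; ⌊_⌋)
open import Relation.Nullary.Decidable using (map′; _×-dec_)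
open import Relation.Unary using (Decidable)

open Equivalence using (to; from)

private variable
  A B : Set
  P Q : A → Set
  m n : ℕ
  xs : List A

HasSize-resp-⇔ : (∀ a → P a ⇔ Q a) → HasSize P n → HasSize Q n
HasSize-resp-⇔ P⇔Q (xs , u , mem , len) = xs , u , (λ a → ⇔-trans (mem a) (P⇔Q a)) , len

HasSize-unique : HasSize P m → HasSize P n → m ≡ n
HasSize-unique (xs , u , mem , refl) (ys , u′ , mem′ , refl) =
  ↭-length (∼bag⇒↭ (unique∧set⇒bag u u′ λ {a} → ⇔-trans (mem a) (⇔-sym (mem′ a))))

HasSize-≢0 : {a : A} → HasSize P n → P a → n ≢ 0
HasSize-≢0 {a = a} ([] , _ , mem , refl) pa _ = case from (mem a) pa of λ ()
HasSize-≢0 (_ ∷ _ , _ , _ , refl) _ ()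

HasSize-witness : HasSize P n → 0 < n → ∃ P
HasSize-witness (a ∷ _ , _ , mem , _) _ = a , to (mem a) (here refl)
HasSize-witness ([] , _ , _ , refl) ()

HasSize-1⇒≡ : {a a′ : A} → HasSize P 1 → P a → P a′ → a ≡ a′
HasSize-1⇒≡ {a = a} {a′} (_ ∷ [] , _ , mem , _) pa pa′ with from (mem a) pa | from (mem a′) pa′
... | here refl | here refl = refl

HasSize-filter : (P? : Decidable P) → Unique xs →
                 HasSize (λ a → a ∈ xs × P a) (length (filter P? xs))
HasSize-filter P? u = _ , filter⁺ P? u , (λ a → mk⇔ (∈-filter⁻ P?) (uncurry (∈-filter⁺ P?))) , refl

HasSize-Fin : HasSize {Fin n} (λ _ → ⊤) n
HasSize-Fin {n} = List.allFin n , allFin⁺ n , (λ α → mk⇔ (const tt) (const (∈-allFin α))) , length-tabulate _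

∃∈? : Decidable P → (xs : List A) → Dec (∃ λ a → a ∈ xs × P a)
∃∈? P? xs = map′ find (λ (_ , a∈ , pa) → lose a∈ pa) (any? P? xs)

HasSize-decidable : (P? : Decidable P) → HasSize P (length (filter P? (List.allFin n)))
HasSize-decidable P? = HasSize-resp-⇔ (λ α → mk⇔ proj₂ (∈-allFin α ,_)) (HasSize-filter P? (allFin⁺ _))

Unique-map⁺-on : {f : A → B} → All P xs → (∀ {a a′} → P a → P a′ → f a ≡ f a′ → a ≡ a′) →
                 Unique xs → Unique (map f xs)
Unique-map⁺-on [] _ [] = []
Unique-map⁺-on (pa ∷ pxs) inj (a∉ ∷ u) =
  All.map⁺ (All.zipWith (λ (pa′ , a≢a′) → a≢a′ ∘ inj pa pa′) (pxs , a∉)) ∷ Unique-map⁺-on pxs inj u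

HasSize-bijection : (f : A → B) (g : B → A) →
                    (∀ {a} → P a → Q (f a)) → (∀ {b} → Q b → P (g b)) →
                    (∀ {a} → P a → g (f a) ≡ a) → (∀ {b} → Q b → f (g b) ≡ b) →
                    HasSize P n → HasSize Q n
HasSize-bijection {P = P} {Q = Q} f g fP gQ gf fg (xs , u , mem , refl) =
  map f xs , Unique-map⁺-on Pxs injective u , mem′ , length-map f xs
  where
  Pxs : All P xs
  Pxs = All.tabulate (λ {a} → to (mem a))
  injective : ∀ {a a′} → P a → P a′ → f a ≡ f a′ → a ≡ a′
  injective pa pa′ eq = trans (sym (gf pa)) (trans (cong g eq) (gf pa′))
  mem′ : ∀ b → (b ∈ map f xs) ⇔ Q b
  mem′ b = mk⇔ (λ b∈ → let (a , a∈ , b≡fa) = ∈-map⁻ f b∈ in subst Q (sym b≡fa) (fP (to (mem a) a∈)))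
               (λ qb → subst (_∈ map f xs) (fg qb) (∈-map⁺ f (from (mem (g b)) (gQ qb))))

suc∈map-suc⇔ : {α : Fin n} {αs : List (Fin n)} → (suc α ∈ map suc αs) ⇔ (α ∈ αs)
suc∈map-suc⇔ {αs = αs} = mk⇔
  (λ s∈ → let a , a∈ , eq = ∈-map⁻ Fin.suc s∈ in subst (_∈ αs) (sym (Finₚ.suc-injective eq)) a∈)
  (∈-map⁺ Fin.suc)

zero∉map-suc : {αs : List (Fin n)} → ¬ (zero ∈ map suc αs)
zero∉map-suc z∈ with ∈-map⁻ Fin.suc z∈
... | _ , _ , ()

HasSize-suc-∉ : {P : Fin (suc n) → Set} → ¬ P zero → HasSize (P ∘ suc) m → HasSize P m
HasSize-suc-∉ {P = P} ¬P0 (αs , u , mem , len) =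
  map suc αs , Unique-map⁺ Finₚ.suc-injective u , mem′ , trans (length-map suc αs) len
  where
  mem′ : ∀ α → (α ∈ map suc αs) ⇔ P α
  mem′ zero    = mk⇔ (⊥-elim ∘ zero∉map-suc) (⊥-elim ∘ ¬P0)
  mem′ (suc α) = ⇔-trans suc∈map-suc⇔ (mem α)

HasSize-suc-∈ : {P : Fin (suc n) → Set} → P zero → HasSize (P ∘ suc) m → HasSize P (suc m)
HasSize-suc-∈ {P = P} P0 (αs , u , mem , len) =
  zero ∷ map suc αs , All.tabulate zero≢ ∷ Unique-map⁺ Finₚ.suc-injective u , mem′ ,
  cong suc (trans (length-map suc αs) len)
  where
  zero≢ : ∀ {β} → β ∈ map suc αs → zero ≢ β
  zero≢ β∈ refl = zero∉map-suc β∈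
  mem′ : ∀ α → (α ∈ zero ∷ map suc αs) ⇔ P α
  mem′ zero    = mk⇔ (const P0) (const (here refl))
  mem′ (suc α) = mk⇔ (λ { (here ()) ; (there s∈) → to (mem α) (to suc∈map-suc⇔ s∈) })
                     (there ∘ from suc∈map-suc⇔ ∘ from (mem α))

⌊⌋≡true⇔ : {X : Set} (x? : Dec X) → (⌊ x? ⌋ ≡ true) ⇔ X
⌊⌋≡true⇔ (yes x) = mk⇔ (const x) (const refl)
⌊⌋≡true⇔ (no ¬x) = mk⇔ (λ ()) (⊥-elim ∘ ¬x)

∧≡true⇔ : {x y : Bool} → (x ∧ y ≡ true) ⇔ (x ≡ true × y ≡ true)
∧≡true⇔ = ⇔-trans (⇔-sym T-≡) (⇔-trans T-∧ (T-≡ ×-⇔ T-≡))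

HasSize-count : (f : Fin n → Bool) → HasSize (λ α → f α ≡ true) (count f)
HasSize-count {zero}  f = [] , [] , (λ ()) , refl
HasSize-count {suc n} f with f zero in f0
... | true  = HasSize-suc-∈ f0 (HasSize-count (f ∘ suc))
... | false = HasSize-suc-∉ (λ f0≡true → case trans (sym f0) f0≡true of λ ()) (HasSize-count (f ∘ suc))

∑ : List A → (A → ℕ) → ℕ
∑ []       w = 0
∑ (a ∷ xs) w = w a + ∑ xs w

𝟙[_] : {X : Set} → Dec X → ℕ
𝟙[ yes _ ] = 1
𝟙[ no  _ ] = 0

length-filter≡∑𝟙 : (P? : Decidable P) (xs : List A) → length (filter P? xs) ≡ ∑ xs (λ a → 𝟙[ P? a ])
length-filter≡∑𝟙 P? []       = refl
length-filter≡∑𝟙 P? (a ∷ xs) with P? a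
... | yes _ = cong suc (length-filter≡∑𝟙 P? xs)
... | no  _ = length-filter≡∑𝟙 P? xs

∑-cong-∈ : {f g : A → ℕ} → (∀ {a} → a ∈ xs → f a ≡ g a) → ∑ xs f ≡ ∑ xs g
∑-cong-∈ {xs = []}     _   = refl
∑-cong-∈ {xs = a ∷ xs} f≡g = cong₂ _+_ (f≡g (here refl)) (∑-cong-∈ (f≡g ∘ there))

∑-const : (xs : List A) (m : ℕ) → ∑ xs (const m) ≡ length xs * m
∑-const []       m = refl
∑-const (a ∷ xs) m = cong (m +_) (∑-const xs m)

∑-+ : (xs : List A) (f g : A → ℕ) → ∑ xs (λ a → f a + g a) ≡ ∑ xs f + ∑ xs g
∑-+ []       f g = refl
∑-+ (a ∷ xs) f g = trans (cong (f a + g a +_) (∑-+ xs f g)) (interchange (f a) (g a) (∑ xs f) (∑ xs g))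

∑-swap : (xs : List A) (ys : List B) (h : A → B → ℕ) →
         ∑ xs (λ a → ∑ ys (h a)) ≡ ∑ ys (λ b → ∑ xs (λ a → h a b))
∑-swap []       ys h = sym (trans (∑-const ys 0) (*-zeroʳ (length ys)))
∑-swap (a ∷ xs) ys h = trans (cong (∑ ys (h a) +_) (∑-swap xs ys h))
                             (sym (∑-+ ys (h a) (λ b → ∑ xs (λ a′ → h a′ b))))

∑-partition : (P? : Decidable P) (xs : List A) (w : A → ℕ) →
              ∑ xs w ≡ ∑ (filter P? xs) w + ∑ (filter (¬? ∘ P?) xs) w
∑-partition P? []       w = refl
∑-partition P? (a ∷ xs) w with P? a
... | yes _ = trans (cong (w a +_) (∑-partition P? xs w)) (sym (+-assoc (w a) _ _))
... | no  _ = trans (cong (w a +_) (∑-partition P? xs w)) (x∙yz≈y∙xz (w a) (∑ (filter P? xs) w) _)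

HasSize-∩≡∑𝟙 : {R : A → Set} (R? : Decidable R) {cs : List A} → Unique cs → (∀ c → (c ∈ cs) ⇔ Q c) →
               HasSize (λ c → Q c × R c) m → m ≡ ∑ cs (λ c → 𝟙[ R? c ])
HasSize-∩≡∑𝟙 R? {cs} u mem size = trans
  (HasSize-unique size (HasSize-resp-⇔ (λ c → mem c ×-⇔ ⇔-refl) (HasSize-filter R? u)))
  (length-filter≡∑𝟙 R? cs)

double-counting : {R : A → B → Set} (R? : ∀ a b → Dec (R a b)) {nP nQ m m′ : ℕ} →
                  HasSize P nP → HasSize Q nQ →
                  (∀ {a} → P a → HasSize (λ b → Q b × R a b) m) →
                  (∀ {b} → Q b → HasSize (λ a → P a × R a b) m′) →
                  nP * m ≡ nQ * m′
double-counting R? {m = m} {m′} (as , uP , memP , refl) (bs , uQ , memQ , refl) fibreP fibreQ = begin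
  length as * m                                ≡⟨ ∑-const as m ⟨
  ∑ as (const m)                               ≡⟨ ∑-cong-∈ fibreP-sum ⟩
  ∑ as (λ a → ∑ bs (λ b → 𝟙[ R? a b ]))        ≡⟨ ∑-swap as bs _ ⟩
  ∑ bs (λ b → ∑ as (λ a → 𝟙[ R? a b ]))        ≡⟨ ∑-cong-∈ fibreQ-sum ⟨
  ∑ bs (const m′)                              ≡⟨ ∑-const bs m′ ⟩
  length bs * m′                               ∎
  where
  open ≡-Reasoning
  fibreP-sum : ∀ {a} → a ∈ as → m ≡ ∑ bs (λ b → 𝟙[ R? a b ])
  fibreP-sum a∈ = HasSize-∩≡∑𝟙 (R? _) uQ memQ (fibreP (to (memP _) a∈))
  fibreQ-sum : ∀ {b} → b ∈ bs → m′ ≡ ∑ as (λ a → 𝟙[ R? a b ])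
  fibreQ-sum b∈ = HasSize-∩≡∑𝟙 (λ a → R? a _) uP memP (fibreQ (to (memQ _) b∈))

Closed : (A → A → Set) → List A → Set
Closed R xs = ∀ {a a′} → R a a′ → a ∈ xs → a′ ∈ xs

module _ {R : A → A → Set} (R-equiv : IsEquivalence R) (_≟_ : DecidableEquality A)
         {w : A → ℕ} (w-invariant : ∀ {a a′} → R a a′ → w a ≡ w a′) where
  open IsEquivalence R-equiv renaming (refl to R-refl; sym to R-sym; trans to R-trans)
  open import Data.List.Membership.DecPropositional _≟_ using (_∈?_)

  module _ {a : A} {cl : List A} (∈cl⇔ : ∀ a′ → (a′ ∈ cl) ⇔ R a a′) where

    ∑-class : Unique xs → Closed R xs → a ∈ xs → HasSize (R a) m → ∑ (filter (_∈? cl) xs) w ≡ m * w a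
    ∑-class {xs = xs} {m = m} u closed a∈ size = begin
      ∑ (filter (_∈? cl) xs) w              ≡⟨ ∑-cong-∈ {xs = filter (_∈? cl) xs} w≡wa ⟩
      ∑ (filter (_∈? cl) xs) (const (w a))  ≡⟨ ∑-const (filter (_∈? cl) xs) (w a) ⟩
      length (filter (_∈? cl) xs) * w a     ≡⟨ cong (_* w a) (HasSize-unique class-size size) ⟩
      m * w a                               ∎
      where
      open ≡-Reasoning
      w≡wa : ∀ {z} → z ∈ filter (_∈? cl) xs → w z ≡ w a
      w≡wa z∈ = sym (w-invariant (to (∈cl⇔ _) (proj₂ (∈-filter⁻ (_∈? cl) {xs = xs} z∈))))
      class-size : HasSize (R a) (length (filter (_∈? cl) xs))
      class-size = HasSize-resp-⇔ (λ z → mk⇔ (to (∈cl⇔ z) ∘ proj₂) (λ r → closed r a∈ , from (∈cl⇔ z) r))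
                                  (HasSize-filter (_∈? cl) u)

    Closed-outside-class : Closed R xs → Closed R (filter (¬? ∘ (_∈? cl)) xs)
    Closed-outside-class {xs = xs} closed {z} {z′} r z∈ =
      let z∈xs , z∉cl = ∈-filter⁻ (¬? ∘ (_∈? cl)) {xs = xs} z∈ in
      ∈-filter⁺ (¬? ∘ (_∈? cl)) (closed r z∈xs)
                (λ z′∈cl → z∉cl (from (∈cl⇔ z) (R-trans (to (∈cl⇔ z′) z′∈cl) (R-sym r))))

  private
    classSize∣∑-fuel : ∀ fuel (xs : List A) → length xs ≤ fuel → Unique xs → Closed R xs →
                      (∀ {a} → a ∈ xs → HasSize (R a) m) → m ∣ ∑ xs w
    classSize∣∑-fuel _ [] _ _ _ _ = _ ∣0
    classSize∣∑-fuel {m = m} (suc fuel) xs@(a ∷ rest) (s≤s len≤) u closed size with size (here refl)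
    ... | cl , _ , ∈cl⇔ , _ =
      subst (m ∣_) (sym (∑-partition (_∈? cl) xs w)) (∣m∣n⇒∣m+n class∣ others∣)
      where
      class∣ : m ∣ ∑ (filter (_∈? cl) xs) w
      class∣ = subst (m ∣_) (sym (∑-class ∈cl⇔ u closed (here refl) (size (here refl)))) (m∣m*n (w a))
      others-shorter : length (filter (¬? ∘ (_∈? cl)) xs) ≤ fuel
      others-shorter = subst (λ ys → length ys ≤ fuel)
        (sym (filter-reject (¬? ∘ (_∈? cl)) (λ a∉cl → a∉cl (from (∈cl⇔ a) R-refl))))
        (≤-trans (length-filter (¬? ∘ (_∈? cl)) rest) len≤)
      others∣ : m ∣ ∑ (filter (¬? ∘ (_∈? cl)) xs) w
      others∣ = classSize∣∑-fuel fuel _ others-shorter (filter⁺ (¬? ∘ (_∈? cl)) u)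
                                 (Closed-outside-class ∈cl⇔ closed)
                                 (size ∘ proj₁ ∘ ∈-filter⁻ (¬? ∘ (_∈? cl)) {xs = xs})

  classSize∣∑ : Unique xs → Closed R xs → (∀ {a} → a ∈ xs → HasSize (R a) m) → m ∣ ∑ xs w
  classSize∣∑ = classSize∣∑-fuel _ _ ≤-refl

classSize∣length : {R : A → A → Set} → IsEquivalence R → DecidableEquality A →
                   Unique xs → Closed R xs → (∀ {a} → a ∈ xs → HasSize (R a) m) → m ∣ length xs
classSize∣length {xs = xs} R-equiv _≟_ u closed size =
  subst (_ ∣_) (trans (∑-const xs 1) (*-identityʳ (length xs)))
        (classSize∣∑ R-equiv _≟_ {w = const 1} (const refl) u closed size)

∣*⇒xOf∣ : {c0 ℓ y : ℕ} (2≤ℓ : 2 ≤ ℓ) → c0 ∣ y * ℓ → xOf c0 ℓ 2≤ℓ ∣ y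
∣*⇒xOf∣ {c0} {ℓ} {y} 2≤ℓ c0∣yℓ = coprime-divisor (coprime-/gcd c0 ℓ) x∣ℓ′y
  where
  g = gcd c0 ℓ
  instance
    _ : NonZero g
    _ = ≢-nonZero (gcd[m,n]≢0 c0 ℓ (inj₂ (2≤⇒≢0 2≤ℓ)))
  x∣ℓ′y : c0 / g ∣ (ℓ / g) * y
  x∣ℓ′y = subst (c0 / g ∣_) (*-comm y (ℓ / g)) (*-cancelʳ-∣ g (subst₂ _∣_
    (sym (m/n*n≡m (gcd[m,n]∣m c0 ℓ)))
    (trans (cong (y *_) (sym (m/n*n≡m (gcd[m,n]∣n c0 ℓ)))) (sym (*-assoc y (ℓ / g) g)))
    c0∣yℓ))

lookup-∘ₚ : (g h : Perm n) (α : Fin n) → lookup (g ∘ₚ h) α ≡ lookup g (lookup h α)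
lookup-∘ₚ g h = lookup∘tabulate _

module Automorphisms {v b : ℕ} {blk : Fin b → Subset v} {G : List (Perm v)}
                     (blk-injective : ∀ i j → blk i ≡ blk j → i ≡ j) (AG : AutGroup blk G) where
  open AutGroup AG

  private variable
    g h : Perm v
    j j′ j″ : Fin b

  inv : g ∈ G → Perm v
  inv g∈ = proj₁ (inv∈ _ g∈)

  inv∈G : (g∈ : g ∈ G) → inv g∈ ∈ G
  inv∈G g∈ = proj₁ (proj₂ (inv∈ _ g∈))

  inv-cancelˡ : (g∈ : g ∈ G) (α : Fin v) → lookup (inv g∈) (lookup g α) ≡ α
  inv-cancelˡ {g} g∈ α = begin
    lookup (inv g∈) (lookup g α)  ≡⟨ lookup-∘ₚ (inv g∈) g α ⟨
    lookup (inv g∈ ∘ₚ g) α        ≡⟨ cong (λ p → lookup p α) (proj₂ (proj₂ (inv∈ _ g∈))) ⟩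
    lookup (allFin v) α           ≡⟨ lookup-allFin α ⟩
    α                             ∎
    where open ≡-Reasoning

  inv-cancelʳ : (g∈ : g ∈ G) (α : Fin v) → lookup g (lookup (inv g∈) α) ≡ α
  inv-cancelʳ g∈ α = is-perm _ (inv∈G g∈) _ _ (inv-cancelˡ g∈ (lookup (inv g∈) α))

  maps-id : MapsBlock blk (allFin v) j j
  maps-id {j} α = cong (lookup (blk j)) (sym (lookup-allFin α))

  maps-∘ : MapsBlock blk g j j′ → MapsBlock blk h j′ j″ → MapsBlock blk (h ∘ₚ g) j j″
  maps-∘ {g} {h = h} {j″ = j″} g-maps h-maps α =
    trans (g-maps α) (trans (h-maps (lookup g α)) (cong (lookup (blk j″)) (sym (lookup-∘ₚ h g α))))

  maps-inv : (g∈ : g ∈ G) → MapsBlock blk g j j′ → MapsBlock blk (inv g∈) j′ j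
  maps-inv {j′ = j′} g∈ g-maps α =
    trans (cong (lookup (blk j′)) (sym (inv-cancelʳ g∈ α))) (sym (g-maps (lookup (inv g∈) α)))

  maps-of-inv : (g∈ : g ∈ G) → MapsBlock blk (inv g∈) j j′ → MapsBlock blk g j′ j
  maps-of-inv {g} {j′ = j′} g∈ g⁻¹-maps α =
    trans (cong (lookup (blk j′)) (sym (inv-cancelˡ g∈ α))) (sym (g⁻¹-maps (lookup g α)))

  maps-functional : g ∈ G → MapsBlock blk g j j′ → MapsBlock blk g j j″ → j′ ≡ j″
  maps-functional {j′ = j′} {j″ = j″} g∈ g-maps g-maps′ =
    blk-injective j′ j″ (Pointwise-≡⇒≡ (ext λ α →
      trans (maps-inv g∈ g-maps α) (sym (maps-inv g∈ g-maps′ α))))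

  blockImage : g ∈ G → Fin b → Fin b
  blockImage g∈ j = proj₁ (aut _ g∈ j)

  maps-blockImage : (g∈ : g ∈ G) (j : Fin b) → MapsBlock blk g j (blockImage g∈ j)
  maps-blockImage g∈ j = proj₂ (aut _ g∈ j)

  blockImage-inv-cancelˡ : (g∈ : g ∈ G) (j : Fin b) → blockImage (inv∈G g∈) (blockImage g∈ j) ≡ j
  blockImage-inv-cancelˡ g∈ j =
    maps-functional (inv∈G g∈) (maps-blockImage (inv∈G g∈) _) (maps-inv g∈ (maps-blockImage g∈ j))

  blockImage-inv-cancelʳ : (g∈ : g ∈ G) (j : Fin b) → blockImage g∈ (blockImage (inv∈G g∈) j) ≡ j
  blockImage-inv-cancelʳ g∈ j =
    maps-functional g∈ (maps-blockImage g∈ _) (maps-of-inv g∈ (maps-blockImage (inv∈G g∈) j))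

module Classes {v b d c : ℕ} {blk : Fin b → Subset v} {G : List (Perm v)} {cls : Fin v → Fin d}
               (blk-injective : ∀ i j → blk i ≡ blk j → i ≡ j) (AG : AutGroup blk G)
               (IP : InvPartition blk G cls c) where
  open AutGroup AG
  open InvPartition IP
  open Automorphisms blk-injective AG public

  private variable
    g h : Perm v
    σ τ : Perm d
    j j′ j″ : Fin b
    α β : Fin v
    δ : Fin d

  InBlock? : ∀ α j → Dec (InBlock blk α j)
  InBlock? α j = lookup (blk j) α ≟ᵇ true

  MapsBlock? : ∀ g j j′ → Dec (MapsBlock blk g j j′)
  MapsBlock? g j j′ = Finₚ.all? (λ α → lookup (blk j) α ≟ᵇ lookup (blk j′) (lookup g α))

  Induces? : ∀ g σ → Dec (Induces blk G cls g σ)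
  Induces? g σ = Finₚ.all? (λ α → lookup σ (cls α) Finₚ.≟ cls (lookup g α))

  class-size : (δ : Fin d) → HasSize (λ α → cls α ≡ δ) c
  class-size δ = subst (HasSize _) (classSize δ)
                       (HasSize-resp-⇔ (λ α → ⌊⌋≡true⇔ (cls α Finₚ.≟ δ)) (HasSize-count _))

  meet-size : (j : Fin b) (δ : Fin d) → HasSize (λ α → InBlock blk α j × cls α ≡ δ) (meet blk G cls j δ)
  meet-size j δ = HasSize-resp-⇔ (λ α → ⇔-trans ∧≡true⇔ (⇔-refl ×-⇔ ⌊⌋≡true⇔ (cls α Finₚ.≟ δ)))
                                 (HasSize-count _)

  representative : Fin d → Fin v
  representative δ = proj₁ (HasSize-witness (class-size δ) (≤-trans (s≤s z≤n) 2≤c))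

  cls-representative : (δ : Fin d) → cls (representative δ) ≡ δ
  cls-representative δ = proj₂ (HasSize-witness (class-size δ) (≤-trans (s≤s z≤n) 2≤c))

  induced : Perm v → Perm d
  induced g = tabulate (λ δ → cls (lookup g (representative δ)))

  induces-induced : g ∈ G → Induces blk G cls g (induced g)
  induces-induced g∈ α = trans (lookup∘tabulate _ (cls α)) (invariant _ g∈ _ _ (cls-representative (cls α)))

  induces-id : Induces blk G cls (allFin v) (allFin d)
  induces-id α = trans (lookup-allFin (cls α)) (cong cls (sym (lookup-allFin α)))

  induces-∘ : Induces blk G cls g σ → Induces blk G cls h τ → Induces blk G cls (g ∘ₚ h) (σ ∘ₚ τ)
  induces-∘ {g} {σ} {h} {τ} g↦σ h↦τ α = begin
    lookup (σ ∘ₚ τ) (cls α)      ≡⟨ lookup-∘ₚ σ τ (cls α) ⟩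
    lookup σ (lookup τ (cls α))  ≡⟨ cong (lookup σ) (h↦τ α) ⟩
    lookup σ (cls (lookup h α))  ≡⟨ g↦σ (lookup h α) ⟩
    cls (lookup g (lookup h α))  ≡⟨ cong cls (lookup-∘ₚ g h α) ⟨
    cls (lookup (g ∘ₚ h) α)      ∎
    where open ≡-Reasoning

  induces-fixing : (∀ α → lookup g α ≡ α) → Induces blk G cls g σ → ∀ δ → lookup σ δ ≡ δ
  induces-fixing {g} {σ} g-fixes g↦σ δ = begin
    lookup σ δ                                 ≡⟨ cong (lookup σ) (cls-representative δ) ⟨
    lookup σ (cls (representative δ))          ≡⟨ g↦σ (representative δ) ⟩
    cls (lookup g (representative δ))          ≡⟨ cong cls (g-fixes _) ⟩
    cls (representative δ)                     ≡⟨ cls-representative δ ⟩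
    δ                                          ∎
    where open ≡-Reasoning

  induced-inv-cancelˡ : (g∈ : g ∈ G) (δ : Fin d) → lookup (induced (inv g∈)) (lookup (induced g) δ) ≡ δ
  induced-inv-cancelˡ {g} g∈ δ = trans (sym (lookup-∘ₚ (induced (inv g∈)) (induced g) δ))
    (induces-fixing {g = inv g∈ ∘ₚ g} {σ = induced (inv g∈) ∘ₚ induced g}
                    (λ α → trans (lookup-∘ₚ (inv g∈) g α) (inv-cancelˡ g∈ α))
                    (induces-∘ {g = inv g∈} {σ = induced (inv g∈)} {h = g} {τ = induced g}
                               (induces-induced (inv∈G g∈)) (induces-induced g∈)) δ)

  induced-inv-cancelʳ : (g∈ : g ∈ G) (δ : Fin d) → lookup (induced g) (lookup (induced (inv g∈)) δ) ≡ δ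
  induced-inv-cancelʳ {g} g∈ δ = trans (sym (lookup-∘ₚ (induced g) (induced (inv g∈)) δ))
    (induces-fixing {g = g ∘ₚ inv g∈} {σ = induced g ∘ₚ induced (inv g∈)}
                    (λ α → trans (lookup-∘ₚ g (inv g∈) α) (inv-cancelʳ g∈ α))
                    (induces-∘ {g = g} {σ = induced g} {h = inv g∈} {τ = induced (inv g∈)}
                               (induces-induced g∈) (induces-induced (inv∈G g∈))) δ)

  induced-inv-∘-cancelˡ : (g∈ : g ∈ G) (τ : Perm d) → induced (inv g∈) ∘ₚ (induced g ∘ₚ τ) ≡ τ
  induced-inv-∘-cancelˡ {g} g∈ τ = Pointwise-≡⇒≡ (ext λ δ →
    trans (lookup-∘ₚ (induced (inv g∈)) (induced g ∘ₚ τ) δ)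
          (trans (cong (lookup (induced (inv g∈))) (lookup-∘ₚ (induced g) τ δ)) (induced-inv-cancelˡ g∈ _)))

  induced-inv-∘-cancelʳ : (g∈ : g ∈ G) (σ : Perm d) → induced g ∘ₚ (induced (inv g∈) ∘ₚ σ) ≡ σ
  induced-inv-∘-cancelʳ {g} g∈ σ = Pointwise-≡⇒≡ (ext λ δ →
    trans (lookup-∘ₚ (induced g) (induced (inv g∈) ∘ₚ σ) δ)
          (trans (cong (lookup (induced g)) (lookup-∘ₚ (induced (inv g∈)) σ δ)) (induced-inv-cancelʳ g∈ _)))

  InK-id : InK blk G cls (allFin v)
  InK-id = id∈ , λ α → cong cls (lookup-allFin α)

  InK-∘ : InK blk G cls g → InK blk G cls h → InK blk G cls (g ∘ₚ h)
  InK-∘ {g} {h} (g∈ , g-fixes) (h∈ , h-fixes) =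
    comp∈ g h g∈ h∈ , λ α → trans (cong cls (lookup-∘ₚ g h α)) (trans (g-fixes _) (h-fixes α))

  InK-inv : (g∈K : InK blk G cls g) → InK blk G cls (inv (proj₁ g∈K))
  InK-inv (g∈ , g-fixes) = inv∈G g∈ , λ α → trans (sym (g-fixes _)) (cong cls (inv-cancelʳ g∈ α))

  InK-conj : (g∈ : g ∈ G) → InK blk G cls h → InK blk G cls (g ∘ₚ (h ∘ₚ inv g∈))
  InK-conj {g} {h} g∈ (h∈ , h-fixes) = comp∈ _ _ g∈ (comp∈ _ _ h∈ (inv∈G g∈)) , conj-fixes
    where
    open ≡-Reasoning
    conj-fixes : ∀ α → cls (lookup (g ∘ₚ (h ∘ₚ inv g∈)) α) ≡ cls α
    conj-fixes α = begin
      cls (lookup (g ∘ₚ (h ∘ₚ inv g∈)) α)      ≡⟨ cong cls (lookup-∘ₚ g (h ∘ₚ inv g∈) α) ⟩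
      cls (lookup g (lookup (h ∘ₚ inv g∈) α))  ≡⟨ invariant g g∈ _ _ h-fixes′ ⟩
      cls (lookup g (lookup (inv g∈) α))       ≡⟨ cong cls (inv-cancelʳ g∈ α) ⟩
      cls α                                    ∎
      where
      h-fixes′ : cls (lookup (h ∘ₚ inv g∈) α) ≡ cls (lookup (inv g∈) α)
      h-fixes′ = trans (cong cls (lookup-∘ₚ h (inv g∈) α)) (h-fixes _)

  KOrbit-isEquivalence : IsEquivalence (KOrbit blk G cls)
  KOrbit-isEquivalence = record
    { refl  = allFin v , InK-id , lookup-allFin _
    ; sym   = λ { {α} (g , g∈K , refl) → inv (proj₁ g∈K) , InK-inv g∈K , inv-cancelˡ (proj₁ g∈K) α }
    ; trans = λ { {α} (g , g∈K , refl) (h , h∈K , refl) → h ∘ₚ g , InK-∘ h∈K g∈K , lookup-∘ₚ h g α }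
    }

  KOrbit-cls : KOrbit blk G cls α β → cls α ≡ cls β
  KOrbit-cls {α} (g , (_ , g-fixes) , refl) = sym (g-fixes α)

  InK∘-induces : InK blk G cls h → Induces blk G cls g σ → Induces blk G cls (h ∘ₚ g) σ
  InK∘-induces {h} {g} (_ , h-fixes) g↦σ α =
    trans (g↦σ α) (trans (sym (h-fixes _)) (cong cls (sym (lookup-∘ₚ h g α))))

  induces-same⇒InK : ∀ {g′} → g ∈ G → (g′∈ : g′ ∈ G) → Induces blk G cls g σ → Induces blk G cls g′ σ →
                     InK blk G cls (g ∘ₚ inv g′∈)
  induces-same⇒InK {g} {σ} {g′} g∈ g′∈ g↦σ g′↦σ = comp∈ _ _ g∈ (inv∈G g′∈) , λ α → begin
    cls (lookup (g ∘ₚ inv g′∈) α)        ≡⟨ cong cls (lookup-∘ₚ g (inv g′∈) α) ⟩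
    cls (lookup g (lookup (inv g′∈) α))  ≡⟨ g↦σ _ ⟨
    lookup σ (cls (lookup (inv g′∈) α))  ≡⟨ g′↦σ _ ⟩
    cls (lookup g′ (lookup (inv g′∈) α)) ≡⟨ cong cls (inv-cancelʳ g′∈ α) ⟩
    cls α                                ∎
    where open ≡-Reasoning

  BlockKOrbit : Fin b → Fin b → Set
  BlockKOrbit j j′ = ∃ λ g → InK blk G cls g × MapsBlock blk g j j′

  BlockKOrbit-isEquivalence : IsEquivalence BlockKOrbit
  BlockKOrbit-isEquivalence = record
    { refl  = allFin v , InK-id , maps-id
    ; sym   = λ (g , g∈K , g-maps) → inv (proj₁ g∈K) , InK-inv g∈K , maps-inv (proj₁ g∈K) g-maps
    ; trans = λ (g , g∈K , g-maps) (h , h∈K , h-maps) →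
                h ∘ₚ g , InK-∘ h∈K g∈K , maps-∘ {g = g} {h = h} g-maps h-maps
    }

  BlockKOrbit-conj : ∀ {j₁ j₁′ j₂ j₂′} (g∈ : g ∈ G) → MapsBlock blk g j₁ j₁′ → MapsBlock blk g j₂ j₂′ →
                     BlockKOrbit j₁ j₂ → BlockKOrbit j₁′ j₂′
  BlockKOrbit-conj {g} g∈ g-maps₁ g-maps₂ (h , h∈K , h-maps) =
    g ∘ₚ (h ∘ₚ inv g∈) , InK-conj g∈ h∈K ,
    maps-∘ {g = h ∘ₚ inv g∈} {h = g} (maps-∘ {g = inv g∈} {h = h} (maps-inv g∈ g-maps₁) h-maps) g-maps₂

  BlockKOrbit? : ∀ j j′ → Dec (BlockKOrbit j j′)
  BlockKOrbit? j j′ = map′ (λ (g , g∈ , g-fixes , g-maps) → g , (g∈ , g-fixes) , g-maps)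
                           (λ (g , (g∈ , g-fixes) , g-maps) → g , g∈ , g-fixes , g-maps)
    (∃∈? (λ g → Finₚ.all? (λ α → cls (lookup g α) Finₚ.≟ cls α) ×-dec MapsBlock? g j j′) G)

  blockKOrbitSize : Fin b → ℕ
  blockKOrbitSize j = length (filter (BlockKOrbit? j) (List.allFin b))

  BlockKOrbit-size : (j : Fin b) → HasSize (BlockKOrbit j) (blockKOrbitSize j)
  BlockKOrbit-size j = HasSize-decidable (BlockKOrbit? j)

module FlagTransitiveAction {v k lam b d c : ℕ} {blk : Fin b → Subset v} {G : List (Perm v)}
                            {cls : Fin v → Fin d} (des : Design2 blk k lam) (AG : AutGroup blk G)
                            (FT : FlagTransitive blk G) (IP : InvPartition blk G cls c) where
  open Design2 des
  open AutGroup AG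
  open Classes blk-inj AG IP public

  private variable
    σ : Perm d
    nX : ℕ

  block-size : (j : Fin b) → HasSize (λ α → InBlock blk α j) k
  block-size j = subst (HasSize _) (trans (cong ∣_∣ (tabulate∘lookup (blk j))) (blk-size j))
                       (HasSize-count (lookup (blk j)))

  block-point : (j : Fin b) → ∃ λ α → InBlock blk α j
  block-point j = HasSize-witness (block-size j) (≤-trans (s≤s z≤n) 2<k)

  block-transitive : (j j′ : Fin b) → ∃ λ g → g ∈ G × MapsBlock blk g j j′
  block-transitive j j′ =
    let α , α∈ = block-point j
        β , β∈ = block-point j′
        g , g∈ , _ , g-maps = FT α j β j′ α∈ β∈
    in g , g∈ , g-maps

  BlockKOrbit-size-transfer : (j j′ : Fin b) → HasSize (BlockKOrbit j) m → HasSize (BlockKOrbit j′) m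
  BlockKOrbit-size-transfer j j′ with block-transitive j j′
  ... | g , g∈ , g-maps = HasSize-bijection (blockImage g∈) (blockImage (inv∈G g∈))
    (λ {j₁} → BlockKOrbit-conj g∈ g-maps (maps-blockImage g∈ j₁))
    (λ {j₂} → BlockKOrbit-conj (inv∈G g∈) (maps-inv g∈ g-maps) (maps-blockImage (inv∈G g∈) j₂))
    (λ {j₁} _ → blockImage-inv-cancelˡ g∈ j₁)
    (λ {j₂} _ → blockImage-inv-cancelʳ g∈ j₂)

  blockKOrbitSize∣b : (j : Fin b) → blockKOrbitSize j ∣ b
  blockKOrbitSize∣b j = subst (blockKOrbitSize j ∣_) (length-tabulate id)
    (classSize∣length BlockKOrbit-isEquivalence Finₚ._≟_ (allFin⁺ b) (λ _ _ → ∈-allFin _)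
                      (λ {j′} _ → BlockKOrbit-size-transfer j j′ (BlockKOrbit-size j)))

  Carries : Fin b → Perm d → Fin b → Set
  Carries i σ j = ∃ λ g → g ∈ G × Induces blk G cls g σ × MapsBlock blk g i j

  Carries? : ∀ i σ j → Dec (Carries i σ j)
  Carries? i σ j = ∃∈? (λ g → Induces? g σ ×-dec MapsBlock? g i j) G

  carried-blocks-size : (i : Fin b) → InD blk G cls σ → HasSize (λ j → ⊤ × Carries i σ j) (blockKOrbitSize i)
  carried-blocks-size {σ} i (g , g∈ , g↦σ) =
    HasSize-resp-⇔ (λ j → mk⇔ (λ h∈Kg → tt , carries h∈Kg) (kernel-coset ∘ proj₂))
                   (BlockKOrbit-size-transfer i (blockImage g∈ i) (BlockKOrbit-size i))
    where
    carries : ∀ {j} → BlockKOrbit (blockImage g∈ i) j → Carries i σ j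
    carries (h , h∈K , h-maps) = h ∘ₚ g , comp∈ h g (proj₁ h∈K) g∈ , InK∘-induces {g = g} {σ = σ} h∈K g↦σ ,
                                 maps-∘ {g = g} {h = h} (maps-blockImage g∈ i) h-maps
    kernel-coset : ∀ {j} → Carries i σ j → BlockKOrbit (blockImage g∈ i) j
    kernel-coset (g′ , g′∈ , g′↦σ , g′-maps) =
      g′ ∘ₚ inv g∈ , induces-same⇒InK {σ = σ} g′∈ g∈ g′↦σ g↦σ ,
      maps-∘ {g = inv g∈} {h = g′} (maps-inv g∈ (maps-blockImage g∈ i)) g′-maps

  carrying-perms-size : (i j : Fin b) → HasSize (InX blk G cls i) nX →
                        HasSize (λ σ → InD blk G cls σ × Carries i σ j) nX
  carrying-perms-size i j with block-transitive i j
  ... | g , g∈ , g-maps = HasSize-bijection {P = InX blk G cls i} (induced g ∘ₚ_) (induced (inv g∈) ∘ₚ_)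
    (λ {τ} → to-coset {τ}) (λ {σ} → from-coset {σ})
    (λ {τ} _ → induced-inv-∘-cancelˡ g∈ τ) (λ {σ} _ → induced-inv-∘-cancelʳ g∈ σ)
    where
    to-coset : ∀ {τ} → InX blk G cls i τ → InD blk G cls (induced g ∘ₚ τ) × Carries i (induced g ∘ₚ τ) j
    to-coset {τ} (t , t∈ , t-maps , t↦τ) =
      let gt↦στ = induces-∘ {g = g} {σ = induced g} {h = t} {τ = τ} (induces-induced g∈) t↦τ in
      (g ∘ₚ t , comp∈ g t g∈ t∈ , gt↦στ) ,
      (g ∘ₚ t , comp∈ g t g∈ t∈ , gt↦στ , maps-∘ {g = t} {h = g} t-maps g-maps)
    from-coset : ∀ {σ} → InD blk G cls σ × Carries i σ j → InX blk G cls i (induced (inv g∈) ∘ₚ σ)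
    from-coset {σ} (_ , h , h∈ , h↦σ , h-maps) =
      inv g∈ ∘ₚ h , comp∈ _ h (inv∈G g∈) h∈ , maps-∘ {g = h} {h = inv g∈} h-maps (maps-inv g∈ g-maps) ,
      induces-∘ {g = inv g∈} {σ = induced (inv g∈)} {h = h} {τ = σ} (induces-induced (inv∈G g∈)) h↦σ

  index*blockKOrbitSize≡b : ∀ {nD idx} (i : Fin b) → HasSize (InD blk G cls) nD →
                            HasSize (InX blk G cls i) nX → nD ≡ idx * nX → idx * blockKOrbitSize i ≡ b
  index*blockKOrbitSize≡b {nX} {nD} {idx} i D-size X-size nD≡idx*nX =
    *-cancelʳ-≡ _ _ nX {{≢-nonZero nX≢0}} (begin
    idx * y * nX   ≡⟨ xy∙z≈xz∙y idx y nX ⟩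
    idx * nX * y   ≡⟨ cong (_* y) nD≡idx*nX ⟨
    nD * y         ≡⟨ double-counting (Carries? i) D-size HasSize-Fin (λ {σ} → carried-blocks-size {σ} i)
                                      (λ {j} _ → carrying-perms-size i j X-size) ⟩
    b * nX         ∎)
    where
    open ≡-Reasoning
    y = blockKOrbitSize i
    nX≢0 : nX ≢ 0
    nX≢0 = HasSize-≢0 {a = allFin d} X-size (allFin v , id∈ , maps-id , induces-id)

module Proposition2p3 {v k lam b d c ℓ c0 : ℕ} {blk : Fin b → Subset v} {G : List (Perm v)}
                      {cls : Fin v → Fin d} (des : Design2 blk k lam) (AG : AutGroup blk G)
                      (FT : FlagTransitive blk G) (IP : InvPartition blk G cls c) (2≤ℓ : 2 ≤ ℓ)
                      (meet≡ℓ : ∀ j δ → meet blk G cls j δ ≢ 0 → meet blk G cls j δ ≡ ℓ)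
                      (K-orbit-size : ∀ α → HasSize (KOrbit blk G cls α) c0) (i : Fin b) where
  open FlagTransitiveAction des AG FT IP

  Meets : Fin b → Fin d → Set
  Meets j δ = ∃ λ α → InBlock blk α j × cls α ≡ δ

  Meets? : ∀ j δ → Dec (Meets j δ)
  Meets? j δ = Finₚ.any? (λ α → InBlock? α j ×-dec (cls α Finₚ.≟ δ))

  meet-size-ℓ : ∀ {j δ} → Meets j δ → HasSize (λ α → InBlock blk α j × cls α ≡ δ) ℓ
  meet-size-ℓ {j} {δ} (_ , α∈ , α↦δ) =
    subst (HasSize _) (meet≡ℓ j δ (HasSize-≢0 (meet-size j δ) (α∈ , α↦δ))) (meet-size j δ)

  XOrbit⇔Meets : ∀ {α} → InBlock blk α i → ∀ δ → XOrbit blk G cls i (cls α) δ ⇔ Meets i δ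
  XOrbit⇔Meets {α} α∈ δ = mk⇔
    (λ (σ , (g , g∈ , g-maps , g↦σ) , σα≡δ) →
       lookup g α , trans (sym (g-maps α)) α∈ , trans (sym (g↦σ α)) σα≡δ)
    (λ (β , β∈ , β↦δ) → let g , g∈ , gα≡β , g-maps = FT α i β i α∈ β∈ in
       induced g , (g , g∈ , g-maps , induces-induced g∈) ,
       trans (induces-induced g∈ α) (trans (cong cls gα≡β) β↦δ))

  Meets-size : HasSize (Meets i) (k /[ ℓ , 2≤ℓ ])
  Meets-size = subst (HasSize (Meets i)) (sym k/ℓ≡classesMet) (HasSize-decidable (Meets? i))
    where
    classesMet = length (filter (Meets? i) (List.allFin d))
    instance
      _ : NonZero ℓ
      _ = ≢-nonZero (2≤⇒≢0 2≤ℓ)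
    class-of : ∀ {α} → InBlock blk α i → HasSize (λ δ → Meets i δ × cls α ≡ δ) 1
    class-of {α} α∈ = cls α ∷ [] , [] ∷ [] ,
      (λ δ → mk⇔ (λ { (here refl) → (α , α∈ , refl) , refl }) (λ (_ , α↦δ) → here (sym α↦δ))) , refl
    k*1≡classesMet*ℓ : k * 1 ≡ classesMet * ℓ
    k*1≡classesMet*ℓ = double-counting (λ α δ → cls α Finₚ.≟ δ) (block-size i)
                                       (HasSize-decidable (Meets? i)) class-of meet-size-ℓ
    k/ℓ≡classesMet : k /[ ℓ , 2≤ℓ ] ≡ classesMet
    k/ℓ≡classesMet = trans (cong (_/ ℓ) (trans (sym (*-identityʳ k)) k*1≡classesMet*ℓ))
                           (m*n/n≡m classesMet ℓ)

  X-orbit : ∃ λ δ → HasSize (XOrbit blk G cls i δ) (k /[ ℓ , 2≤ℓ ])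
  X-orbit = let α , α∈ = block-point i in
    cls α , HasSize-resp-⇔ (λ δ → ⇔-sym (XOrbit⇔Meets α∈ δ)) Meets-size

  K-fixes-points : c0 ≡ 1 → ∀ {g} → InK blk G cls g → ∀ α → lookup g α ≡ α
  K-fixes-points c0≡1 {g} g∈K α =
    HasSize-1⇒≡ (subst (HasSize _) c0≡1 (K-orbit-size α)) (g , g∈K , refl)
                (IsEquivalence.refl KOrbit-isEquivalence)

  blockKOrbitSize≡1 : c0 ≡ 1 → blockKOrbitSize i ≡ 1
  blockKOrbitSize≡1 c0≡1 = HasSize-unique (BlockKOrbit-size i) (i ∷ [] , [] ∷ [] , singleton , refl)
    where
    singleton : ∀ j → (j ∈ i ∷ []) ⇔ BlockKOrbit i j
    singleton j = mk⇔ (λ { (here refl) → IsEquivalence.refl BlockKOrbit-isEquivalence })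
      (λ (g , g∈K , g-maps) → here (sym (maps-functional (proj₁ g∈K)
         (λ α → cong (lookup (blk i)) (sym (K-fixes-points c0≡1 g∈K α))) g-maps)))

  α₀ : Fin v
  α₀ = proj₁ (block-point i)

  δ₀ : Fin d
  δ₀ = cls α₀

  Δ₀ : List (Fin v)
  Δ₀ = proj₁ (class-size δ₀)

  Δ₀-unique : Unique Δ₀
  Δ₀-unique = proj₁ (proj₂ (class-size δ₀))

  ∈Δ₀⇔ : ∀ α → (α ∈ Δ₀) ⇔ (cls α ≡ δ₀)
  ∈Δ₀⇔ = proj₁ (proj₂ (proj₂ (class-size δ₀)))

  |Δ₀|≡c : length Δ₀ ≡ c
  |Δ₀|≡c = proj₂ (proj₂ (proj₂ (class-size δ₀)))

  Δ₀-closed : Closed (KOrbit blk G cls) Δ₀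
  Δ₀-closed α~α′ α∈ = from (∈Δ₀⇔ _) (trans (sym (KOrbit-cls α~α′)) (to (∈Δ₀⇔ _) α∈))

  c0∣c : c0 ∣ c
  c0∣c = subst (c0 ∣_) |Δ₀|≡c
    (classSize∣length KOrbit-isEquivalence Finₚ._≟_ Δ₀-unique Δ₀-closed (λ {α} _ → K-orbit-size α))

  KBlocks : List (Fin b)
  KBlocks = filter (BlockKOrbit? i) (List.allFin b)

  ∈KBlocks⇒BlockKOrbit : ∀ {j} → j ∈ KBlocks → BlockKOrbit i j
  ∈KBlocks⇒BlockKOrbit = proj₂ ∘ ∈-filter⁻ (BlockKOrbit? i) {xs = List.allFin b}

  incidences : Fin v → ℕ
  incidences α = ∑ KBlocks (λ j → 𝟙[ InBlock? α j ])

  incidences-size : ∀ α → HasSize (λ j → BlockKOrbit i j × InBlock blk α j) (incidences α)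
  incidences-size α = subst (HasSize _) (length-filter≡∑𝟙 (InBlock? α) KBlocks)
    (HasSize-resp-⇔ (λ j → mk⇔ (λ (j∈ , α∈j) → ∈KBlocks⇒BlockKOrbit j∈ , α∈j)
                               (λ (i~j , α∈j) → ∈-filter⁺ (BlockKOrbit? i) (∈-allFin j) i~j , α∈j))
                    (HasSize-filter (InBlock? α) (filter⁺ (BlockKOrbit? i) (allFin⁺ b))))

  incidences-invariant : ∀ {α α′} → KOrbit blk G cls α α′ → incidences α ≡ incidences α′
  incidences-invariant {α} (g , g∈K@(g∈ , _) , refl) = HasSize-unique
    (HasSize-bijection (blockImage g∈) (blockImage (inv∈G g∈)) forth back
                       (λ {j} _ → blockImage-inv-cancelˡ g∈ j) (λ {j} _ → blockImage-inv-cancelʳ g∈ j)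
                       (incidences-size α))
    (incidences-size (lookup g α))
    where
    open IsEquivalence BlockKOrbit-isEquivalence using () renaming (trans to ~-trans)
    forth : ∀ {j} → BlockKOrbit i j × InBlock blk α j →
            BlockKOrbit i (blockImage g∈ j) × InBlock blk (lookup g α) (blockImage g∈ j)
    forth {j} (i~j , α∈j) =
      ~-trans i~j (g , g∈K , maps-blockImage g∈ j) , trans (sym (maps-blockImage g∈ j α)) α∈j
    back : ∀ {j} → BlockKOrbit i j × InBlock blk (lookup g α) j →
           BlockKOrbit i (blockImage (inv∈G g∈) j) × InBlock blk α (blockImage (inv∈G g∈) j)
    back {j} (i~j , gα∈j) = ~-trans i~j (inv g∈ , InK-inv g∈K , maps-blockImage (inv∈G g∈) j) ,
      trans (cong (lookup (blk (blockImage (inv∈G g∈) j))) (sym (inv-cancelˡ g∈ α)))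
            (trans (sym (maps-blockImage (inv∈G g∈) j (lookup g α))) gα∈j)

  ∑-incidences : ∑ Δ₀ incidences ≡ blockKOrbitSize i * ℓ
  ∑-incidences = begin
    ∑ Δ₀ incidences                                   ≡⟨ ∑-swap Δ₀ KBlocks _ ⟩
    ∑ KBlocks (λ j → ∑ Δ₀ (λ α → 𝟙[ InBlock? α j ]))  ≡⟨ ∑-cong-∈ meets-ℓ ⟨
    ∑ KBlocks (const ℓ)                               ≡⟨ ∑-const KBlocks ℓ ⟩
    blockKOrbitSize i * ℓ                             ∎
    where
    open ≡-Reasoning
    meets-ℓ : ∀ {j} → j ∈ KBlocks → ℓ ≡ ∑ Δ₀ (λ α → 𝟙[ InBlock? α j ])
    meets-ℓ {j} j∈ with ∈KBlocks⇒BlockKOrbit j∈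
    ... | h , (_ , h-fixes) , h-maps = HasSize-∩≡∑𝟙 (λ α → InBlock? α j) Δ₀-unique ∈Δ₀⇔
      (HasSize-resp-⇔ (λ _ → mk⇔ swap swap)
         (meet-size-ℓ (lookup h α₀ , trans (sym (h-maps α₀)) (proj₂ (block-point i)) , h-fixes α₀)))

  c0∣blockKOrbitSize*ℓ : c0 ∣ blockKOrbitSize i * ℓ
  c0∣blockKOrbitSize*ℓ = subst (c0 ∣_) ∑-incidences
    (classSize∣∑ KOrbit-isEquivalence Finₚ._≟_ incidences-invariant Δ₀-unique Δ₀-closed
                 (λ {α} _ → K-orbit-size α))

  x∣blockKOrbitSize : xOf c0 ℓ 2≤ℓ ∣ blockKOrbitSize i
  x∣blockKOrbitSize = ∣*⇒xOf∣ 2≤ℓ c0∣blockKOrbitSize*ℓ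

  x∣b : xOf c0 ℓ 2≤ℓ ∣ b
  x∣b = ∣-trans x∣blockKOrbitSize (blockKOrbitSize∣b i)

  module _ {nD nX idx : ℕ} (D-size : HasSize (InD blk G cls) nD) (X-size : HasSize (InX blk G cls i) nX)
           (nD≡idx*nX : nD ≡ idx * nX) where
    open ≡-Reasoning

    index≡b : c0 ≡ 1 → idx ≡ b
    index≡b c0≡1 = begin
      idx                      ≡⟨ *-identityʳ idx ⟨
      idx * 1                  ≡⟨ cong (idx *_) (blockKOrbitSize≡1 c0≡1) ⟨
      idx * blockKOrbitSize i  ≡⟨ index*blockKOrbitSize≡b {idx = idx} i D-size X-size nD≡idx*nX ⟩
      b                        ∎

    index∣b/x : Σ ℕ λ y → b ≡ y * xOf c0 ℓ 2≤ℓ × idx ∣ y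
    index∣b/x with x∣blockKOrbitSize
    ... | divides q y≡q*x = idx * q , b≡idx*q*x , m∣m*n q
      where
      b≡idx*q*x : b ≡ idx * q * xOf c0 ℓ 2≤ℓ
      b≡idx*q*x = begin
        b                        ≡⟨ index*blockKOrbitSize≡b {idx = idx} i D-size X-size nD≡idx*nX ⟨
        idx * blockKOrbitSize i  ≡⟨ cong (idx *_) y≡q*x ⟩
        idx * (q * xOf c0 ℓ 2≤ℓ) ≡⟨ *-assoc idx q _ ⟨
        idx * q * xOf c0 ℓ 2≤ℓ   ∎

proposition2p3 : {v k lam b d c ℓ c0 : ℕ}
    (blk : Fin b → Subset v) (G : List (Perm v)) (cls : Fin v → Fin d) →
    Design2 blk k lam →
    AutGroup blk G →
    FlagTransitive blk G →
    InvPartition blk G cls c →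
    (2≤ℓ : 2 ≤ ℓ) →
    (∀ i δ → meet blk G cls i δ ≢ 0 → meet blk G cls i δ ≡ ℓ) →
    (∀ α → HasSize (KOrbit blk G cls α) c0) →
    (i : Fin b) →
      (∃[ δ ] HasSize (XOrbit blk G cls i δ) (k /[ ℓ , 2≤ℓ ]))
      × (c0 ≡ 1 → ∀ nD nX idx → HasSize (InD blk G cls) nD →
           HasSize (InX blk G cls i) nX → nD ≡ idx * nX → idx ≡ b)
      × (1 < c0 →
           (c0 ∣ c)
           × (xOf c0 ℓ 2≤ℓ ∣ b)
           × (∀ nD nX idx → HasSize (InD blk G cls) nD →
                HasSize (InX blk G cls i) nX → nD ≡ idx * nX →
                Σ ℕ λ y → b ≡ y * xOf c0 ℓ 2≤ℓ × idx ∣ y))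
proposition2p3 blk G cls des AG FT IP 2≤ℓ meet≡ℓ K-orbit-size i =
  X-orbit ,
  (λ c0≡1 _ _ _ D-size X-size nD≡idx*nX → index≡b D-size X-size nD≡idx*nX c0≡1) ,
  λ _ → c0∣c , x∣b , λ _ _ _ D-size X-size nD≡idx*nX → index∣b/x D-size X-size nD≡idx*nX
  where open Proposition2p3 des AG FT IP 2≤ℓ meet≡ℓ K-orbit-size i
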